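{- Let $(\mathcal{S},\mathcal{E})$ be a set system in which every element belongs to at most $f$ sets, with costs $1/C\le c_s\le 1$ for all $s\in\mathcal{S}$, and let $0<\epsilon<1/2$ and $L=\lceil\log_{1+\epsilon}(Cn)\rceil+1$ where $n=|\mathcal{E}|$. Suppose each set $s$ is assigned a level $\ell(s)\in\{0,\dots,L\}$, each element $e$ has level $\ell(e)=\max\{\ell(s): s\in\mathcal{S}, e\in s\}$ and weight $w(e)=(1+\epsilon)^{ -\ell(e)}$, and with $W(s)=\sum_{e\in s}w(e)$ the following hold: (i) $0\le W(s)\le c_s$ for every $s\in\mathcal{S}$, and every slack set has level $0$; (ii) every element $e\in\mathcal{E}$ is contained in at least one tight set. Then the collection $\mathcal{S}_{tight}=\{s\in\mathcal{S}: (1+\epsilon)^{ -1}c_s\le W(s)\le c_s\}$ is a set cover of $\mathcal{E}$ whose cost is at most $(1+\epsilon)f$ times the minimum cost of a set cover of $(\mathcal{S},\mathcal{E})$.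
   Context: A set $s$ is called tight if $(1+\epsilon)^{ -1}c_s\le W(s)\le c_s$ and slack if $0\le W(s)<(1+\epsilon)^{ -1}c_s$. The cost of a collection of sets is the sum of their costs.
   Formalization: The costs $c_s$ and the parameters $C$ and $\epsilon$ are taken in ℚ. -}

module Defs where

open import Data.Nat as ℕ using (ℕ; zero; suc)
open import Data.Integer using (+_)
open import Data.Rational as ℚ using (ℚ; 0ℚ; 1ℚ; _+_; _*_; _≤_; _<_; 1/_; _/_)
open import Data.Rational.Properties using (_≟_; _≤?_)
open import Data.Rational.Base using (≢-nonZero)
open import Data.Fin using (Fin)
open import Data.Fin.Subset using (Subset; _∈_)
open import Data.Fin.Subset.Properties using (_∈?_)
open import Data.Vec using (tabulate)
open import Data.List using (List; foldr; allFin; filter; length)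
open import Data.Bool using (if_then_else_; _∧_)
open import Data.Product using (Σ; _×_)
open import Relation.Nullary using (yes; no; does)

_^_ : ℚ → ℕ → ℚ
x ^ zero = 1ℚ
x ^ suc k = x * (x ^ k)

-- total inverse (0⁻¹ = 0); only ever applied to nonzero values here
inv : ℚ → ℚ
inv x with x ≟ 0ℚ
... | yes _ = 0ℚ
... | no x≢0 = 1/_ x {{≢-nonZero x≢0}}

ℕtoℚ : ℕ → ℚ
ℕtoℚ k = (+ k) / 1

Σ[_] : {m : ℕ} → (Fin m → ℚ) → ℚ
Σ[_] {m} g = foldr (λ i acc → g i + acc) 0ℚ (allFin m)

-- A set system on elements Fin n with sets indexed by Fin m:
-- S i is the i-th set, as a subset of the element set.
SetSystem : ℕ → ℕ → Set
SetSystem n m = Fin m → Subset n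

frequency : {n m : ℕ} → SetSystem n m → Fin n → ℕ
frequency {n} {m} S e = length (filter (λ i → e ∈? S i) (allFin m))

-- level of an element: max level of the sets containing it (0 if none)
elemLevel : {n m : ℕ} → SetSystem n m → (Fin m → ℕ) → Fin n → ℕ
elemLevel {n} {m} S lvl e =
  foldr (λ i acc → if does (e ∈? S i) then lvl i ℕ.⊔ acc else acc) 0 (allFin m)

weight : {n m : ℕ} → ℚ → SetSystem n m → (Fin m → ℕ) → Fin n → ℚ
weight ε S lvl e = inv ((1ℚ + ε) ^ elemLevel S lvl e)

W : {n m : ℕ} → ℚ → SetSystem n m → (Fin m → ℕ) → Fin m → ℚ
W ε S lvl s = Σ[ (λ e → if does (e ∈? S s) then weight ε S lvl e else 0ℚ) ]

Tight : {n m : ℕ} → ℚ → SetSystem n m → (Fin m → ℚ) → (Fin m → ℕ) → Fin m → Set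
Tight ε S c lvl s = (inv (1ℚ + ε) * c s ≤ W ε S lvl s) × (W ε S lvl s ≤ c s)

Slack : {n m : ℕ} → ℚ → SetSystem n m → (Fin m → ℚ) → (Fin m → ℕ) → Fin m → Set
Slack ε S c lvl s = (0ℚ ≤ W ε S lvl s) × (W ε S lvl s < inv (1ℚ + ε) * c s)

tightSets : {n m : ℕ} → ℚ → SetSystem n m → (Fin m → ℚ) → (Fin m → ℕ) → Subset m
tightSets ε S c lvl = tabulate λ s →
  does (inv (1ℚ + ε) * c s ≤? W ε S lvl s) ∧ does (W ε S lvl s ≤? c s)

IsSetCover : {n m : ℕ} → SetSystem n m → Subset m → Set
IsSetCover {n} {m} S T = (e : Fin n) → Σ (Fin m) (λ i → (i ∈ T) × (e ∈ S i))

cost : {m : ℕ} → (Fin m → ℚ) → Subset m → ℚ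
cost c T = Σ[ (λ i → if does (i ∈? T) then c i else 0ℚ) ]

-- The proof is the classical primal-dual argument; the level structure (the
-- bounds on C, ε, L and the slack condition) is only needed to make the
-- weights exist, not for the approximation guarantee itself.  Write q = 1+ε,
-- w(e) for the element weights and W(s) = Σ_{e∈s} w(e) for the load of s.
--
--   * Covering: by (ii) each element lies in a tight set.
--   * A tight set s satisfies c_s ≤ q·W(s), so cost(S_tight) ≤ q·Σ_s W(s).
--   * Charging: each element is counted in at most f loads, so
--     Σ_s W(s) ≤ f·Σ_e w(e).
--   * Weak duality: nonnegative weights with W(s) ≤ c_s for every s have
--     total weight at most the cost of any cover T.
module Submission where

open import Defs
open import Data.Nat as ℕ using (ℕ; suc; zero)
open import Data.Integer as ℤ using (+_)
import Data.Integer.Properties as ℤP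
open import Data.Rational
  using (ℚ; mkℚ; 0ℚ; 1ℚ; _+_; _*_; _≤_; _<_; _/_; NonNegative; 1/_; positive; nonNegative)
open import Data.Rational.Properties
open import Data.Rational.Base using (≢-nonZero)
open import Data.Nat.Coprimality as Cop using (1-coprimeTo)
open import Relation.Binary.PropositionalEquality
open import Level using (0ℓ)
open import Relation.Unary using (Pred; Decidable)
open import Data.Fin using (Fin)
open import Data.Fin.Subset using (Subset; _∈_)
open import Data.Fin.Subset.Properties using (_∈?_)
open import Data.List using (List; []; _∷_; foldr; allFin; filter; length)
open import Data.List.Membership.Propositional using () renaming (_∈_ to _∈L_)
open import Data.List.Relation.Unary.Any using (here; there)
open import Data.List.Membership.Propositional.Properties using (∈-allFin)
open import Data.Bool using (Bool; true; false; if_then_else_; _∧_)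
open import Relation.Nullary using (yes; no; does; Dec)
open import Data.Empty using (⊥-elim)
open import Data.Product using (Σ; _×_; _,_; proj₁; proj₂)
open import Function using (_∘_)
open import Data.Vec.Properties using (lookup∘tabulate; []=⇒lookup; lookup⇒[]=)

ℕtoℚ-mkℚ : ∀ k → ℕtoℚ k ≡ mkℚ (+ k) 0 (Cop.sym (1-coprimeTo k))
ℕtoℚ-mkℚ k = normalize-coprime (Cop.sym (1-coprimeTo k))

ℕtoℚ-suc : ∀ k → ℕtoℚ (suc k) ≡ 1ℚ + ℕtoℚ k
ℕtoℚ-suc k rewrite ℕtoℚ-mkℚ k =
  cong (_/ 1) (cong (λ z → + 1 ℤ.+ z) (sym (ℤP.*-identityʳ (+ k))))

ℕtoℚ-nonNeg : ∀ k → 0ℚ ≤ ℕtoℚ k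
ℕtoℚ-nonNeg zero = ≤-refl
ℕtoℚ-nonNeg (suc k) rewrite ℕtoℚ-suc k =
  +-mono-≤ (<⇒≤ (positive⁻¹ 1ℚ)) (ℕtoℚ-nonNeg k)

ℕtoℚ-mono : ∀ {a b} → a ℕ.≤ b → ℕtoℚ a ≤ ℕtoℚ b
ℕtoℚ-mono {zero} {b} _ = ℕtoℚ-nonNeg b
ℕtoℚ-mono {suc a} {suc b} (ℕ.s≤s a≤b) rewrite ℕtoℚ-suc a | ℕtoℚ-suc b =
  +-monoʳ-≤ 1ℚ (ℕtoℚ-mono a≤b)

-- Finite sums over lists; Σ[ g ] is definitionally sumL g (allFin m).

sumL : {A : Set} → (A → ℚ) → List A → ℚ
sumL g xs = foldr (λ i acc → g i + acc) 0ℚ xs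

module _ {A : Set} where

  sum-mono : ∀ {g h : A → ℚ} → (∀ i → g i ≤ h i) → ∀ xs → sumL g xs ≤ sumL h xs
  sum-mono g≤h [] = ≤-refl
  sum-mono g≤h (x ∷ xs) = +-mono-≤ (g≤h x) (sum-mono g≤h xs)

  sum-nonNeg : ∀ {g : A → ℚ} → (∀ i → 0ℚ ≤ g i) → ∀ xs → 0ℚ ≤ sumL g xs
  sum-nonNeg g≥0 [] = ≤-refl
  sum-nonNeg g≥0 (x ∷ xs) = +-mono-≤ (g≥0 x) (sum-nonNeg g≥0 xs)

  sum-zero : ∀ (xs : List A) → sumL (λ _ → 0ℚ) xs ≡ 0ℚ
  sum-zero [] = refl
  sum-zero (x ∷ xs) = trans (+-identityˡ _) (sum-zero xs)

  sum-scale : ∀ a (g : A → ℚ) xs → sumL (λ i → a * g i) xs ≡ a * sumL g xs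
  sum-scale a g [] = sym (*-zeroʳ a)
  sum-scale a g (x ∷ xs) =
    trans (cong (_+_ (a * g x)) (sum-scale a g xs)) (sym (*-distribˡ-+ a (g x) _))

  sum-single : ∀ {g : A → ℚ} → (∀ i → 0ℚ ≤ g i) → ∀ {x} xs → x ∈L xs → g x ≤ sumL g xs
  sum-single {g} g≥0 (y ∷ xs) (here refl) =
    ≤-trans (≤-reflexive (sym (+-identityʳ (g y)))) (+-monoʳ-≤ (g y) (sum-nonNeg g≥0 xs))
  sum-single {g} g≥0 (y ∷ xs) (there x∈xs) =
    ≤-trans (≤-reflexive (sym (+-identityˡ (g _)))) (+-mono-≤ (g≥0 y) (sum-single g≥0 xs x∈xs))

  sum-count : ∀ {P : Pred A 0ℓ} (P? : Decidable P) a xs →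
    sumL (λ i → if does (P? i) then a else 0ℚ) xs ≡ ℕtoℚ (length (filter P? xs)) * a
  sum-count P? a [] = sym (*-zeroˡ a)
  sum-count P? a (x ∷ xs) with P? x
  ... | yes _ = begin
        a + sumL (λ i → if does (P? i) then a else 0ℚ) xs ≡⟨ cong (_+_ a) (sum-count P? a xs) ⟩
        a + k * a                                         ≡⟨ cong (_+ k * a) (sym (*-identityˡ a)) ⟩
        1ℚ * a + k * a                                    ≡⟨ sym (*-distribʳ-+ a 1ℚ k) ⟩
        (1ℚ + k) * a                                      ≡⟨ cong (_* a) (sym (ℕtoℚ-suc (length (filter P? xs)))) ⟩
        ℕtoℚ (suc (length (filter P? xs))) * a            ∎
    where open ≡-Reasoning
          k = ℕtoℚ (length (filter P? xs))
  ... | no _ = trans (+-identityˡ _) (sum-count P? a xs)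

+-interchange : ∀ a b c d → (a + b) + (c + d) ≡ (a + c) + (b + d)
+-interchange a b c d = begin
  (a + b) + (c + d) ≡⟨ +-assoc a b (c + d) ⟩
  a + (b + (c + d)) ≡⟨ cong (_+_ a) (sym (+-assoc b c d)) ⟩
  a + ((b + c) + d) ≡⟨ cong (λ z → a + (z + d)) (+-comm b c) ⟩
  a + ((c + b) + d) ≡⟨ cong (_+_ a) (+-assoc c b d) ⟩
  a + (c + (b + d)) ≡⟨ sym (+-assoc a c (b + d)) ⟩
  (a + c) + (b + d) ∎
  where open ≡-Reasoning

sum-+ : ∀ {A : Set} (g h : A → ℚ) xs → sumL (λ i → g i + h i) xs ≡ sumL g xs + sumL h xs
sum-+ g h [] = refl
sum-+ g h (x ∷ xs) =
  trans (cong (_+_ (g x + h x)) (sum-+ g h xs)) (+-interchange (g x) (h x) _ _)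

sum-swap : ∀ {A B : Set} (g : A → B → ℚ) xs ys →
  sumL (λ i → sumL (g i) ys) xs ≡ sumL (λ j → sumL (λ i → g i j) xs) ys
sum-swap g [] ys = sym (sum-zero ys)
sum-swap g (x ∷ xs) ys =
  trans (cong (_+_ (sumL (g x) ys)) (sum-swap g xs ys))
        (sym (sum-+ (g x) (λ j → sumL (λ i → g i j) xs) ys))

pow-pos : ∀ {x} → 0ℚ < x → ∀ k → 0ℚ < x ^ k
pow-pos x>0 zero = positive⁻¹ 1ℚ
pow-pos {x} x>0 (suc k) =
  positive⁻¹ _ {{pos*pos⇒pos x {{positive x>0}} (x ^ k) {{positive (pow-pos x>0 k)}}}}

inv-nonNeg : ∀ {x} → 0ℚ < x → 0ℚ ≤ inv x
inv-nonNeg {x} x>0 with x ≟ 0ℚ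
... | yes _ = ≤-refl
... | no x≢0 = nonNegative⁻¹ x⁻¹ {{pos⇒nonNeg x⁻¹ {{1/pos⇒pos x {{positive x>0}}}}}}
  where x⁻¹ = (1/ x) {{≢-nonZero x≢0}}

inv-inverseʳ : ∀ {x} → 0ℚ < x → x * inv x ≡ 1ℚ
inv-inverseʳ {x} x>0 with x ≟ 0ℚ
... | yes x≡0 = ⊥-elim (<-irrefl (sym x≡0) x>0)
... | no x≢0 = *-inverseʳ x {{≢-nonZero x≢0}}

inv-*-≤⇒≤-* : ∀ {q x y} → 0ℚ < q → inv q * x ≤ y → x ≤ q * y
inv-*-≤⇒≤-* {q} {x} {y} q>0 q⁻¹x≤y = begin
  x               ≡⟨ sym (*-identityˡ x) ⟩
  1ℚ * x          ≡⟨ cong (_* x) (sym (inv-inverseʳ q>0)) ⟩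
  (q * inv q) * x ≡⟨ *-assoc q (inv q) x ⟩
  q * (inv q * x) ≤⟨ *-monoˡ-≤-nonNeg q {{nonNegative (<⇒≤ q>0)}} q⁻¹x≤y ⟩
  q * y           ∎
  where open ≤-Reasoning

restrict : ∀ {k} → Subset k → (Fin k → ℚ) → Fin k → ℚ
restrict U g i = if does (i ∈? U) then g i else 0ℚ

-- load w S s = Σ_{e ∈ s} w(e); W is the load of the level weights,
-- and cost c T = Σ[ restrict T c ] definitionally.
load : ∀ {n m} → (Fin n → ℚ) → SetSystem n m → Fin m → ℚ
load w S s = Σ[ restrict (S s) w ]

restrict-nonNeg : ∀ {k} U {g : Fin k → ℚ} → (∀ i → 0ℚ ≤ g i) → ∀ i → 0ℚ ≤ restrict U g i
restrict-nonNeg U g≥0 i with does (i ∈? U)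
... | true = g≥0 i
... | false = ≤-refl

cost-≤-scaled : ∀ {m} (U : Subset m) (c h : Fin m → ℚ) q → 0ℚ ≤ q → (∀ s → 0ℚ ≤ h s) →
  (∀ s → s ∈ U → c s ≤ q * h s) → cost c U ≤ q * Σ[ h ]
cost-≤-scaled {m} U c h q q≥0 h≥0 bound = begin
  cost c U               ≤⟨ sum-mono termwise (allFin m) ⟩
  sumL (λ s → q * h s) (allFin m) ≡⟨ sum-scale q h (allFin m) ⟩
  q * Σ[ h ]             ∎
  where
  open ≤-Reasoning
  termwise : ∀ s → restrict U c s ≤ q * h s
  termwise s with s ∈? U
  ... | yes s∈U = bound s s∈U
  ... | no _ = ≤-trans (≤-reflexive (sym (*-zeroʳ q))) (*-monoˡ-≤-nonNeg q {{nonNegative q≥0}} (h≥0 s))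

total-load-≤ : ∀ {n m} (S : SetSystem n m) (w : Fin n → ℚ) f → (∀ e → 0ℚ ≤ w e) →
  (∀ e → frequency S e ℕ.≤ f) → Σ[ load w S ] ≤ ℕtoℚ f * Σ[ w ]
total-load-≤ {n} {m} S w f w≥0 freq≤f = begin
  Σ[ load w S ]                                          ≡⟨ sum-swap (λ s e → restrict (S s) w e) (allFin m) (allFin n) ⟩
  sumL (λ e → sumL (λ s → restrict (S s) w e) (allFin m)) (allFin n) ≤⟨ sum-mono perElement (allFin n) ⟩
  sumL (λ e → ℕtoℚ f * w e) (allFin n)                  ≡⟨ sum-scale (ℕtoℚ f) w (allFin n) ⟩
  ℕtoℚ f * Σ[ w ]                                        ∎
  where
  open ≤-Reasoning
  perElement : ∀ e → sumL (λ s → restrict (S s) w e) (allFin m) ≤ ℕtoℚ f * w e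
  perElement e = begin
    sumL (λ s → restrict (S s) w e) (allFin m) ≡⟨ sum-count (λ s → e ∈? S s) (w e) (allFin m) ⟩
    ℕtoℚ (frequency S e) * w e                 ≤⟨ *-monoʳ-≤-nonNeg (w e) {{nonNegative (w≥0 e)}} (ℕtoℚ-mono (freq≤f e)) ⟩
    ℕtoℚ f * w e                               ∎

weight-≤-cover-cost : ∀ {n m} (S : SetSystem n m) (c : Fin m → ℚ) (w : Fin n → ℚ) →
  (∀ e → 0ℚ ≤ w e) → (∀ s → load w S s ≤ c s) →
  (T : Subset m) → IsSetCover S T → Σ[ w ] ≤ cost c T
weight-≤-cover-cost {n} {m} S c w w≥0 load≤c T covT = begin
  Σ[ w ]                                        ≤⟨ sum-mono coveredOnce (allFin n) ⟩
  sumL (λ e → Σ[ charge e ]) (allFin n)         ≡⟨ sum-swap charge (allFin n) (allFin m) ⟩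
  sumL (λ s → sumL (λ e → charge e s) (allFin n)) (allFin m) ≤⟨ sum-mono chargedToCover (allFin m) ⟩
  cost c T                                      ∎
  where
  open ≤-Reasoning
  charge : Fin n → Fin m → ℚ
  charge e = restrict T (λ s → restrict (S s) w e)

  charge≥0 : ∀ e s → 0ℚ ≤ charge e s
  charge≥0 e = restrict-nonNeg T (λ s → restrict-nonNeg (S s) w≥0 e)

  charge-member : ∀ e s → s ∈ T → e ∈ S s → charge e s ≡ w e
  charge-member e s s∈T e∈s with s ∈? T
  ... | no s∉T = ⊥-elim (s∉T s∈T)
  ... | yes _ with e ∈? S s
  ...   | yes _ = refl
  ...   | no e∉s = ⊥-elim (e∉s e∈s)

  coveredOnce : ∀ e → w e ≤ Σ[ charge e ]
  coveredOnce e with covT e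
  ... | s , s∈T , e∈s =
    ≤-trans (≤-reflexive (sym (charge-member e s s∈T e∈s)))
            (sum-single (charge≥0 e) (allFin m) (∈-allFin s))

  chargedToCover : ∀ s → sumL (λ e → charge e s) (allFin n) ≤ restrict T c s
  chargedToCover s with s ∈? T
  ... | yes _ = load≤c s
  ... | no _ = ≤-reflexive (sum-zero (allFin n))

-- tightSets records the conjunction of two decided tests; these read it back.
both-true : {A B : Set} (a? : Dec A) (b? : Dec B) → A → B → does a? ∧ does b? ≡ true
both-true (yes _) (yes _) _ _ = refl
both-true (yes _) (no ¬b) _ b = ⊥-elim (¬b b)
both-true (no ¬a) _ a _ = ⊥-elim (¬a a)

first-true : {A B : Set} (a? : Dec A) (b? : Dec B) → does a? ∧ does b? ≡ true → A
first-true (yes a) _ _ = a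
first-true (no _) _ ()

module _ {n m : ℕ} (ε : ℚ) (S : SetSystem n m) (c : Fin m → ℚ) (lvl : Fin m → ℕ) where

  private
    tightTest : Fin m → Bool
    tightTest s = does (inv (1ℚ + ε) * c s ≤? W ε S lvl s) ∧ does (W ε S lvl s ≤? c s)

  tight⇒∈tightSets : ∀ s → Tight ε S c lvl s → s ∈ tightSets ε S c lvl
  tight⇒∈tightSets s (lower , upper) = lookup⇒[]= s (tightSets ε S c lvl)
    (trans (lookup∘tabulate tightTest s) (both-true (_ ≤? _) (_ ≤? _) lower upper))

  ∈tightSets⇒lower : ∀ s → s ∈ tightSets ε S c lvl → inv (1ℚ + ε) * c s ≤ W ε S lvl s
  ∈tightSets⇒lower s s∈ = first-true (_ ≤? _) (W ε S lvl s ≤? c s)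
    (trans (sym (lookup∘tabulate tightTest s)) ([]=⇒lookup s∈))

weight-nonNeg : ∀ {n m} ε (S : SetSystem n m) lvl → 0ℚ < 1ℚ + ε → ∀ e → 0ℚ ≤ weight ε S lvl e
weight-nonNeg ε S lvl q>0 e = inv-nonNeg (pow-pos q>0 (elemLevel S lvl e))

lemma2p2 : (n m f : ℕ) (S : SetSystem n m) (c : Fin m → ℚ) (C ε : ℚ)
    (lvl : Fin m → ℕ) (L k : ℕ) →
    ((e : Fin n) → frequency S e ℕ.≤ f) →
    0ℚ < C →
    ((s : Fin m) → (inv C ≤ c s) × (c s ≤ 1ℚ)) →
    0ℚ < ε → ε < (+ 1) / 2 →
    C * ℕtoℚ n ≤ (1ℚ + ε) ^ k →
    ((j : ℕ) → j ℕ.< k → (1ℚ + ε) ^ j < C * ℕtoℚ n) →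
    L ≡ suc k →
    ((s : Fin m) → lvl s ℕ.≤ L) →
    ((s : Fin m) → (0ℚ ≤ W ε S lvl s) × (W ε S lvl s ≤ c s)) →
    ((s : Fin m) → Slack ε S c lvl s → lvl s ≡ 0) →
    ((e : Fin n) → Σ (Fin m) (λ s → Tight ε S c lvl s × (e ∈ S s))) →
    IsSetCover S (tightSets ε S c lvl)
    × ((T : Subset m) → IsSetCover S T →
    cost c (tightSets ε S c lvl) ≤ ((1ℚ + ε) * ℕtoℚ f) * cost c T)
lemma2p2 n m f S c C ε lvl L k freq≤f _ _ ε>0 _ _ _ _ _ feasible _ tightCover =
  covers , approx
  where
  q = 1ℚ + ε
  q>0 : 0ℚ < q
  q>0 = positive⁻¹ q {{pos+pos⇒pos 1ℚ ε {{positive ε>0}}}}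
  w : Fin n → ℚ
  w = weight ε S lvl
  w≥0 : ∀ e → 0ℚ ≤ w e
  w≥0 = weight-nonNeg ε S lvl q>0

  covers : IsSetCover S (tightSets ε S c lvl)
  covers e with tightCover e
  ... | s , tight , e∈s = s , tight⇒∈tightSets ε S c lvl s tight , e∈s

  approx : (T : Subset m) → IsSetCover S T →
    cost c (tightSets ε S c lvl) ≤ (q * ℕtoℚ f) * cost c T
  approx T covT = begin
    cost c (tightSets ε S c lvl) ≤⟨ cost-≤-scaled _ c (W ε S lvl) q (<⇒≤ q>0) (proj₁ ∘ feasible)
                                      (λ s s∈ → inv-*-≤⇒≤-* q>0 (∈tightSets⇒lower ε S c lvl s s∈)) ⟩
    q * Σ[ W ε S lvl ]           ≤⟨ *-monoˡ-≤-nonNeg q (total-load-≤ S w f w≥0 freq≤f) ⟩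
    q * (ℕtoℚ f * Σ[ w ])        ≤⟨ *-monoˡ-≤-nonNeg q (*-monoˡ-≤-nonNeg (ℕtoℚ f)
                                      (weight-≤-cover-cost S c w w≥0 (proj₂ ∘ feasible) T covT)) ⟩
    q * (ℕtoℚ f * cost c T)      ≡⟨ sym (*-assoc q (ℕtoℚ f) (cost c T)) ⟩
    (q * ℕtoℚ f) * cost c T      ∎
    where
    open ≤-Reasoning
    instance
      q≥0 : NonNegative q
      q≥0 = nonNegative (<⇒≤ q>0)
      f≥0 : NonNegative (ℕtoℚ f)
      f≥0 = nonNegative (ℕtoℚ-nonNeg f)
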